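{- Let $A,B,q,m$ be (possibly negative) integers with $A+B\geq q\geq 0$. Let $P(w)\in \mathbb{Q}[w]$ be any polynomial of $w$ of degree $q$. Then $$ \sum_{w\in\mathbb{Z}} P(w) \genfrac{[}{]}{0pt}{}{A}{w} \genfrac{[}{]}{0pt}{}{B}{m-w} =\sum_{w\in\mathbb{Z}} P(w) \genfrac{[}{]}{0pt}{}{A}{A-w} \genfrac{[}{]}{0pt}{}{B}{B-m+w}. $$
   Context: For arbitrary (possibly negative) integers $A,B$ the modified binomial coefficient is $\genfrac{[}{]}{0pt}{}{A}{B}=\prod_{i=0}^{A-B-1}\frac{A-i}{A-B-i}$ if $A>B$, $=1$ if $A=B$, and $=0$ if $A<B$. An empty product is defined to be $1$. -}

module Defs where

open import Data.Nat as ℕ using (ℕ; zero; suc; _∸_; _<_; s≤s; z≤n)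
open import Data.Nat.Properties using (m<n⇒0<n∸m)
open import Data.Integer as ℤ using (ℤ; +_; -[1+_])
open import Data.Rational as ℚ using (ℚ; _/_)
open import Data.Vec using (Vec; []; _∷_)

prodLt : (k : ℕ) → ((i : ℕ) → i < k → ℚ) → ℚ
prodLt zero    f = ℚ.1ℚ
prodLt (suc k) f = prodLt k (λ i i<k → f i (ℕ.<-trans i<k (ℕ.n<1+n k))) ℚ.* f k (ℕ.n<1+n k)
  where import Data.Nat as ℕ
        import Data.Nat.Properties as ℕ

-- i-th factor (A - i) / (k - i) of the product, where k = A - B and i < k.
factor : ℤ → (k i : ℕ) → i < k → ℚ
factor A k i i<k = (A ℤ.- + i) / (k ∸ i)
  where instance _ = ℕ.>-nonZero (m<n⇒0<n∸m i<k)

mbinom : ℤ → ℤ → ℚ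
mbinom A B with A ℤ.- B
... | + zero    = ℚ.1ℚ
... | + (suc n) = prodLt (suc n) (factor A (suc n))
... | -[1+ n ]  = ℚ.0ℚ

-- Polynomial of degree q over ℚ: coefficient vector c₀ … c_q (c_i is the
-- coefficient of w^i) whose leading coefficient c_q is nonzero.
evalPoly : ∀ {n} → Vec ℚ n → ℚ → ℚ
evalPoly []       x = ℚ.0ℚ
evalPoly (c ∷ cs) x = c ℚ.+ x ℚ.* evalPoly cs x

leading : ∀ {q} → Vec ℚ (suc q) → ℚ
leading (c ∷ [])       = c
leading (c ∷ (d ∷ cs)) = leading (d ∷ cs)

sumFrom : ℤ → ℕ → (ℤ → ℚ) → ℚ
sumFrom lo zero    f = ℚ.0ℚ
sumFrom lo (suc n) f = f lo ℚ.+ sumFrom (lo ℤ.+ + 1) n f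

sumWindow : ℕ → (ℤ → ℚ) → ℚ
sumWindow N f = sumFrom (ℤ.- (+ N)) (suc (N ℕ.+ N)) f

ℤtoℚ : ℤ → ℚ
ℤtoℚ w = w / 1

-- Write [A over w] = C(A, A − w), where C(A, k) = A(A−1)⋯(A−k+1)/k! for k ≥ 0 and C(A, k) = 0 for
-- k < 0; the right-hand side is then Σ_w P(w) C(A, w) C(B, m − w).  Both kernels f = [_over_] and
-- f = C satisfy Pascal's rule f(A+1, w) = f(A, w) + f(A, w−1) and agree at A = 0, hence for all
-- A ≥ 0.  For any such f the sums S(P; A, B, m) = Σ_w P(w) f(A, w) f(B, m − w) obey
--   S(P; A+1, B, m) = S(P; A, B+1, m) + S(ΔP; A, B, m−1),   ΔP(w) = P(w+1) − P(w),
-- so a unit can be moved between A and B at the price of a sum with a polynomial of lower degree and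
-- A + B lowered by one.  Induction on deg P and then on |A| + |B| reduces both sides to the case
-- A, B ≥ 0, where the kernels coincide; the hypothesis A + B ≥ deg P is preserved by every step and
-- keeps A and B from both being negative.
module Submission where

open import Defs
open import Data.Nat as ℕ using (ℕ; suc)
open import Data.Integer as ℤ using (ℤ; +_; _+_; _-_; ∣_∣)
open import Data.Rational using (ℚ; _*_; 0ℚ)
open import Data.Vec using (Vec)
open import Relation.Binary.PropositionalEquality using (_≡_; _≢_)

open import Data.Integer using (-[1+_])
import Data.Integer.Properties as ℤP
open import Data.Integer.Tactic.RingSolver using (solve-∀)
open import Data.Nat using (zero; _!)
import Data.Nat.Properties as ℕP
import Data.Rational as ℚ
open import Data.Rational using (1ℚ; _/_)
import Data.Rational.Properties as ℚP
open import Algebra.Properties.Group ℚP.+-0-group using () renaming (∙-cancelʳ to +-cancelʳ)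
open import Data.Rational.Solver using (module +-*-Solver)
import Data.Rational.Unnormalised as ℚᵘ
import Data.Rational.Unnormalised.Properties as ℚᵘP
open import Data.Vec using ([]; _∷_)
open import Relation.Binary.PropositionalEquality
  using (refl; sym; trans; cong; cong₂; subst; subst₂; module ≡-Reasoning)
open ≡-Reasoning

fromℚᵘ-+ : ∀ p q → ℚ.fromℚᵘ (p ℚᵘ.+ q) ≡ ℚ.fromℚᵘ p ℚ.+ ℚ.fromℚᵘ q
fromℚᵘ-+ p q = ℚP.toℚᵘ-injective (ℚᵘP.≃-trans (ℚP.toℚᵘ-fromℚᵘ (p ℚᵘ.+ q))
  (ℚᵘP.≃-trans (ℚᵘP.+-cong (ℚᵘP.≃-sym (ℚP.toℚᵘ-fromℚᵘ p)) (ℚᵘP.≃-sym (ℚP.toℚᵘ-fromℚᵘ q)))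
    (ℚᵘP.≃-sym (ℚP.toℚᵘ-homo-+ (ℚ.fromℚᵘ p) (ℚ.fromℚᵘ q)))))

fromℚᵘ-* : ∀ p q → ℚ.fromℚᵘ (p ℚᵘ.* q) ≡ ℚ.fromℚᵘ p * ℚ.fromℚᵘ q
fromℚᵘ-* p q = ℚP.toℚᵘ-injective (ℚᵘP.≃-trans (ℚP.toℚᵘ-fromℚᵘ (p ℚᵘ.* q))
  (ℚᵘP.≃-trans (ℚᵘP.*-cong (ℚᵘP.≃-sym (ℚP.toℚᵘ-fromℚᵘ p)) (ℚᵘP.≃-sym (ℚP.toℚᵘ-fromℚᵘ q)))
    (ℚᵘP.≃-sym (ℚP.toℚᵘ-homo-* (ℚ.fromℚᵘ p) (ℚ.fromℚᵘ q)))))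

ℤtoℚ-+ : ∀ i j → ℤtoℚ (i + j) ≡ ℤtoℚ i ℚ.+ ℤtoℚ j
ℤtoℚ-+ i j = trans (ℚP.fromℚᵘ-cong {ℚᵘ.mkℚᵘ (i + j) 0} {ℚᵘ.mkℚᵘ i 0 ℚᵘ.+ ℚᵘ.mkℚᵘ j 0} (ℚᵘ.*≡* (eq i j)))
                   (fromℚᵘ-+ (ℚᵘ.mkℚᵘ i 0) (ℚᵘ.mkℚᵘ j 0))
  where
  eq : ∀ i j → (i + j) ℤ.* + 1 ≡ (i ℤ.* + 1 + j ℤ.* + 1) ℤ.* + 1
  eq = solve-∀

ℤtoℚ-* : ∀ i j → ℤtoℚ (i ℤ.* j) ≡ ℤtoℚ i * ℤtoℚ j
ℤtoℚ-* i j = fromℚᵘ-* (ℚᵘ.mkℚᵘ i 0) (ℚᵘ.mkℚᵘ j 0)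

ℤtoℚ-pos-* : ∀ m n → ℤtoℚ (+ (m ℕ.* n)) ≡ ℤtoℚ (+ m) * ℤtoℚ (+ n)
ℤtoℚ-pos-* m n = trans (cong ℤtoℚ (ℤP.pos-* m n)) (ℤtoℚ-* (+ m) (+ n))

ℤtoℚ-suc : ∀ i → ℤtoℚ (ℤ.suc i) ≡ 1ℚ ℚ.+ ℤtoℚ i
ℤtoℚ-suc = ℤtoℚ-+ (+ 1)

/-*-ℤtoℚ : ∀ i n .{{_ : ℕ.NonZero n}} → (i / n) * ℤtoℚ (+ n) ≡ ℤtoℚ i
/-*-ℤtoℚ i (suc n) = trans (sym (fromℚᵘ-* (ℚᵘ.mkℚᵘ i n) (ℚᵘ.mkℚᵘ (+ suc n) 0)))
  (ℚP.fromℚᵘ-cong {ℚᵘ.mkℚᵘ i n ℚᵘ.* ℚᵘ.mkℚᵘ (+ suc n) 0} {ℚᵘ.mkℚᵘ i 0} (ℚᵘ.*≡* (eq i (+ suc n))))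
  where
  eq : ∀ i m → (i ℤ.* m) ℤ.* + 1 ≡ i ℤ.* (m ℤ.* + 1)
  eq = solve-∀

*-cancelʳ-≡ : ∀ {p q} r .{{_ : ℚ.NonZero r}} → p * r ≡ q * r → p ≡ q
*-cancelʳ-≡ {p} {q} r pr≡qr = begin
  p                   ≡⟨ sym (ℚP.*-identityʳ p) ⟩
  p * 1ℚ              ≡⟨ cong (p *_) (sym (ℚP.*-inverseʳ r)) ⟩
  p * (r * ℚ.1/ r)    ≡⟨ sym (ℚP.*-assoc p r _) ⟩
  (p * r) * ℚ.1/ r    ≡⟨ cong (_* ℚ.1/ r) pr≡qr ⟩
  (q * r) * ℚ.1/ r    ≡⟨ ℚP.*-assoc q r _ ⟩
  q * (r * ℚ.1/ r)    ≡⟨ cong (q *_) (ℚP.*-inverseʳ r) ⟩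
  q * 1ℚ              ≡⟨ ℚP.*-identityʳ q ⟩
  q                   ∎

ℤtoℚ-nonZero : ∀ n .{{_ : ℕ.NonZero n}} → ℚ.NonZero (ℤtoℚ (+ n))
ℤtoℚ-nonZero n = ℚP.pos⇒nonZero (ℤtoℚ (+ n)) {{ℚP.normalize-pos n 1}}

falling : ℤ → ℕ → ℤ
falling A zero    = + 1
falling A (suc n) = falling A n ℤ.* (A - + n)

falling-suc : ∀ A n → falling (ℤ.suc A) (suc n) ≡ ℤ.suc A ℤ.* falling A n
falling-suc A zero    = eq A
  where
  eq : ∀ A → + 1 ℤ.* (+ 1 + A - + 0) ≡ (+ 1 + A) ℤ.* + 1
  eq = solve-∀
falling-suc A (suc n) = begin
  falling (ℤ.suc A) (suc n) ℤ.* (ℤ.suc A - + suc n) ≡⟨ cong (ℤ._* (ℤ.suc A - + suc n)) (falling-suc A n) ⟩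
  ℤ.suc A ℤ.* falling A n ℤ.* (ℤ.suc A - + suc n)   ≡⟨ eq A (falling A n) (+ n) ⟩
  ℤ.suc A ℤ.* (falling A n ℤ.* (A - + n))           ∎
  where
  eq : ∀ A F n → (+ 1 + A) ℤ.* F ℤ.* (+ 1 + A - (+ 1 + n)) ≡ (+ 1 + A) ℤ.* (F ℤ.* (A - n))
  eq = solve-∀

falling-diagonal : ∀ n → falling (+ n) n ≡ + (n !)
falling-diagonal zero    = refl
falling-diagonal (suc n) = begin
  falling (ℤ.suc (+ n)) (suc n)  ≡⟨ falling-suc (+ n) n ⟩
  + suc n ℤ.* falling (+ n) n    ≡⟨ cong (+ suc n ℤ.*_) (falling-diagonal n) ⟩
  + suc n ℤ.* + (n !)            ≡⟨ ℤP.pos-* (suc n) (n !) ⟨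
  + (suc n !)                    ∎

prodLt-ratio : ∀ j (f : (i : ℕ) → i ℕ.< j → ℚ) {a b : ℤ} →
  (∀ i i<j → f i i<j * ℤtoℚ (b - + i) ≡ ℤtoℚ (a - + i)) →
  prodLt j f * ℤtoℚ (falling b j) ≡ ℤtoℚ (falling a j)
prodLt-ratio zero    f         _     = ℚP.*-identityˡ _
prodLt-ratio (suc j) f {a} {b} ratio = begin
  (prodLt j f′ * f j _) * ℤtoℚ (falling b j ℤ.* (b - + j))
    ≡⟨ cong ((prodLt j f′ * f j _) *_) (ℤtoℚ-* (falling b j) (b - + j)) ⟩
  (prodLt j f′ * f j _) * (ℤtoℚ (falling b j) * ℤtoℚ (b - + j))
    ≡⟨ interchange (prodLt j f′) (f j _) (ℤtoℚ (falling b j)) (ℤtoℚ (b - + j)) ⟩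
  (prodLt j f′ * ℤtoℚ (falling b j)) * (f j _ * ℤtoℚ (b - + j))
    ≡⟨ cong₂ _*_ (prodLt-ratio j f′ (λ i _ → ratio i _)) (ratio j _) ⟩
  ℤtoℚ (falling a j) * ℤtoℚ (a - + j)
    ≡⟨ ℤtoℚ-* (falling a j) (a - + j) ⟨
  ℤtoℚ (falling a (suc j)) ∎
  where
  f′ : (i : ℕ) → i ℕ.< j → ℚ
  f′ i i<j = f i (ℕP.<-trans i<j (ℕP.n<1+n j))
  open +-*-Solver
  interchange : ∀ p q r s → (p * q) * (r * s) ≡ (p * r) * (q * s)
  interchange = solve 4 (λ p q r s → (p :* q) :* (r :* s) := (p :* r) :* (q :* s)) refl

choose : ℤ → ℤ → ℚ
choose A (+ zero)  = 1ℚ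
choose A (+ suc n) = prodLt (suc n) (factor A (suc n))
choose A -[1+ n ]  = 0ℚ

mbinom≡choose : ∀ A B → mbinom A B ≡ choose A (A - B)
mbinom≡choose A B with A - B
... | + zero   = refl
... | + suc n  = refl
... | -[1+ n ] = refl

choose-*-factorial : ∀ A n → choose A (+ n) * ℤtoℚ (+ (n !)) ≡ ℤtoℚ (falling A n)
choose-*-factorial A zero    = ℚP.*-identityˡ _
choose-*-factorial A (suc n) = begin
  prodLt (suc n) (factor A (suc n)) * ℤtoℚ (+ (suc n !))
    ≡⟨ cong (λ k → prodLt (suc n) (factor A (suc n)) * ℤtoℚ k) (falling-diagonal (suc n)) ⟨
  prodLt (suc n) (factor A (suc n)) * ℤtoℚ (falling (+ suc n) (suc n))
    ≡⟨ prodLt-ratio (suc n) (factor A (suc n)) factor-ratio ⟩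
  ℤtoℚ (falling A (suc n)) ∎
  where
  factor-ratio : ∀ i i<k → factor A (suc n) i i<k * ℤtoℚ (+ suc n - + i) ≡ ℤtoℚ (A - + i)
  factor-ratio i i<k = begin
    factor A (suc n) i i<k * ℤtoℚ (+ suc n - + i)
      ≡⟨ cong (λ k → factor A (suc n) i i<k * ℤtoℚ k) (trans (ℤP.m-n≡m⊖n (suc n) i) (ℤP.⊖-≥ (ℕP.<⇒≤ i<k))) ⟩
    factor A (suc n) i i<k * ℤtoℚ (+ (suc n ℕ.∸ i))
      ≡⟨ /-*-ℤtoℚ (A - + i) (suc n ℕ.∸ i) {{ℕ.>-nonZero (ℕP.m<n⇒0<n∸m i<k)}} ⟩
    ℤtoℚ (A - + i) ∎

IsPascal : (ℤ → ℤ → ℚ) → Set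
IsPascal f = ∀ A w → f (ℤ.suc A) w ≡ f A w ℚ.+ f A (ℤ.pred w)

falling-pascal : ∀ A n → falling (ℤ.suc A) (suc n) ≡ falling A (suc n) + + suc n ℤ.* falling A n
falling-pascal A n = trans (falling-suc A n) (split A (falling A n) (+ n))
  where
  split : ∀ A F n → (+ 1 + A) ℤ.* F ≡ F ℤ.* (A - n) + (+ 1 + n) ℤ.* F
  split = solve-∀

choose-isPascal : IsPascal choose
choose-isPascal A -[1+ n ]  = sym (ℚP.+-identityʳ 0ℚ)
choose-isPascal A (+ zero)  = sym (ℚP.+-identityʳ 1ℚ)
choose-isPascal A (+ suc n) = *-cancelʳ-≡ k! {{ℤtoℚ-nonZero (suc n !) {{ℕP._!≢0 (suc n)}}}} (begin
  choose (ℤ.suc A) (+ suc n) * k!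
    ≡⟨ choose-*-factorial (ℤ.suc A) (suc n) ⟩
  ℤtoℚ (falling (ℤ.suc A) (suc n))
    ≡⟨ cong ℤtoℚ (falling-pascal A n) ⟩
  ℤtoℚ (falling A (suc n) + + suc n ℤ.* falling A n)
    ≡⟨ ℤtoℚ-+ (falling A (suc n)) (+ suc n ℤ.* falling A n) ⟩
  ℤtoℚ (falling A (suc n)) ℚ.+ ℤtoℚ (+ suc n ℤ.* falling A n)
    ≡⟨ cong₂ ℚ._+_ (sym (choose-*-factorial A (suc n))) lower-term ⟩
  choose A (+ suc n) * k! ℚ.+ choose A (+ n) * k!
    ≡⟨ ℚP.*-distribʳ-+ k! (choose A (+ suc n)) (choose A (+ n)) ⟨
  (choose A (+ suc n) ℚ.+ choose A (+ n)) * k! ∎)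
  where
  k! : ℚ
  k! = ℤtoℚ (+ (suc n !))
  open +-*-Solver
  swap : ∀ s c f → s * (c * f) ≡ c * (s * f)
  swap = solve 3 (λ s c f → s :* (c :* f) := c :* (s :* f)) refl
  lower-term : ℤtoℚ (+ suc n ℤ.* falling A n) ≡ choose A (+ n) * k!
  lower-term = begin
    ℤtoℚ (+ suc n ℤ.* falling A n)                        ≡⟨ ℤtoℚ-* (+ suc n) (falling A n) ⟩
    ℤtoℚ (+ suc n) * ℤtoℚ (falling A n)                   ≡⟨ cong (ℤtoℚ (+ suc n) *_) (choose-*-factorial A n) ⟨
    ℤtoℚ (+ suc n) * (choose A (+ n) * ℤtoℚ (+ (n !)))    ≡⟨ swap (ℤtoℚ (+ suc n)) (choose A (+ n)) (ℤtoℚ (+ (n !))) ⟩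
    choose A (+ n) * (ℤtoℚ (+ suc n) * ℤtoℚ (+ (n !)))    ≡⟨ cong (choose A (+ n) *_) (ℤtoℚ-pos-* (suc n) (n !)) ⟨
    choose A (+ n) * k!                                   ∎

choose-zero-suc : ∀ n → choose (+ 0) (+ suc n) ≡ 0ℚ
choose-zero-suc n = *-cancelʳ-≡ (ℤtoℚ (+ (suc n !))) {{ℤtoℚ-nonZero (suc n !) {{ℕP._!≢0 (suc n)}}}} (begin
  choose (+ 0) (+ suc n) * ℤtoℚ (+ (suc n !)) ≡⟨ choose-*-factorial (+ 0) (suc n) ⟩
  ℤtoℚ (falling (ℤ.suc -[1+ 0 ]) (suc n))      ≡⟨ cong ℤtoℚ (falling-suc -[1+ 0 ] n) ⟩
  ℤtoℚ (+ 0 ℤ.* falling -[1+ 0 ] n)            ≡⟨ cong ℤtoℚ (ℤP.*-zeroˡ (falling -[1+ 0 ] n)) ⟩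
  0ℚ                                           ≡⟨ ℚP.*-zeroˡ (ℤtoℚ (+ (suc n !))) ⟨
  0ℚ * ℤtoℚ (+ (suc n !))                       ∎)

choose-negative : ∀ A k → 0 ℕ.< k → choose A (ℤ.- + k) ≡ 0ℚ
choose-negative A (suc k) _ = refl

choose-below : ∀ A i {n} → ∣ i ∣ ℕ.< n → choose A (i - + n) ≡ 0ℚ
choose-below A (+ j) {n} j<n = trans (cong (choose A) (trans (ℤP.m-n≡m⊖n j n) (ℤP.⊖-< j<n)))
                                     (choose-negative A (n ℕ.∸ j) (ℕP.m<n⇒0<n∸m j<n))
choose-below A -[1+ j ] {suc n} _ = refl

mbinom[A-k]≡choose : ∀ A k → mbinom A (A - k) ≡ choose A k
mbinom[A-k]≡choose A k = trans (mbinom≡choose A (A - k)) (cong (choose A) (reflect A k))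
  where
  reflect : ∀ A k → A - (A - k) ≡ k
  reflect = solve-∀

mbinom-isPascal : IsPascal mbinom
mbinom-isPascal A w = begin
  mbinom (ℤ.suc A) w
    ≡⟨ mbinom≡choose (ℤ.suc A) w ⟩
  choose (ℤ.suc A) (ℤ.suc A - w)
    ≡⟨ choose-isPascal A (ℤ.suc A - w) ⟩
  choose A (ℤ.suc A - w) ℚ.+ choose A (ℤ.pred (ℤ.suc A - w))
    ≡⟨ ℚP.+-comm (choose A (ℤ.suc A - w)) _ ⟩
  choose A (ℤ.pred (ℤ.suc A - w)) ℚ.+ choose A (ℤ.suc A - w)
    ≡⟨ cong₂ (λ i j → choose A i ℚ.+ choose A j) (lower A w) (upper A w) ⟩
  choose A (A - w) ℚ.+ choose A (A - ℤ.pred w)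
    ≡⟨ cong₂ ℚ._+_ (mbinom≡choose A w) (mbinom≡choose A (ℤ.pred w)) ⟨
  mbinom A w ℚ.+ mbinom A (ℤ.pred w) ∎
  where
  lower : ∀ A w → -[1+ 0 ] + (+ 1 + A - w) ≡ A - w
  lower = solve-∀
  upper : ∀ A w → + 1 + A - w ≡ A - (-[1+ 0 ] + w)
  upper = solve-∀

pascal-unique-on-ℕ : ∀ {f g} → IsPascal f → IsPascal g → (∀ w → f (+ 0) w ≡ g (+ 0) w) →
  ∀ n w → f (+ n) w ≡ g (+ n) w
pascal-unique-on-ℕ f-pascal g-pascal f≗g zero    w = f≗g w
pascal-unique-on-ℕ {f} {g} f-pascal g-pascal f≗g (suc n) w = begin
  f (+ suc n) w                        ≡⟨ f-pascal (+ n) w ⟩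
  f (+ n) w ℚ.+ f (+ n) (ℤ.pred w)    ≡⟨ cong₂ ℚ._+_ (induct w) (induct (ℤ.pred w)) ⟩
  g (+ n) w ℚ.+ g (+ n) (ℤ.pred w)    ≡⟨ g-pascal (+ n) w ⟨
  g (+ suc n) w                        ∎
  where
  induct : ∀ w → f (+ n) w ≡ g (+ n) w
  induct = pascal-unique-on-ℕ {f} {g} f-pascal g-pascal f≗g n

mbinom≗choose-on-ℕ : ∀ n w → mbinom (+ n) w ≡ choose (+ n) w
mbinom≗choose-on-ℕ = pascal-unique-on-ℕ {mbinom} {choose} mbinom-isPascal choose-isPascal at-zero
  where
  at-zero : ∀ w → mbinom (+ 0) w ≡ choose (+ 0) w
  at-zero (+ zero)  = refl
  at-zero (+ suc n) = sym (choose-zero-suc n)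
  at-zero -[1+ n ]  = choose-zero-suc n

sumFrom-cong : ∀ lo n {f g : ℤ → ℚ} → (∀ w → f w ≡ g w) → sumFrom lo n f ≡ sumFrom lo n g
sumFrom-cong lo zero    f≗g = refl
sumFrom-cong lo (suc n) f≗g = cong₂ ℚ._+_ (f≗g lo) (sumFrom-cong (lo + + 1) n f≗g)

sumFrom-+ : ∀ lo n (f g : ℤ → ℚ) → sumFrom lo n (λ w → f w ℚ.+ g w) ≡ sumFrom lo n f ℚ.+ sumFrom lo n g
sumFrom-+ lo zero    f g = sym (ℚP.+-identityʳ 0ℚ)
sumFrom-+ lo (suc n) f g = trans (cong ((f lo ℚ.+ g lo) ℚ.+_) (sumFrom-+ (lo + + 1) n f g))
  (interchange (f lo) (g lo) (sumFrom (lo + + 1) n f) (sumFrom (lo + + 1) n g))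
  where
  open +-*-Solver
  interchange : ∀ a b c d → (a ℚ.+ b) ℚ.+ (c ℚ.+ d) ≡ (a ℚ.+ c) ℚ.+ (b ℚ.+ d)
  interchange = solve 4 (λ a b c d → (a :+ b) :+ (c :+ d) := (a :+ c) :+ (b :+ d)) refl

sumFrom-vanishing : ∀ lo n {f : ℤ → ℚ} → (∀ w → f w ≡ 0ℚ) → sumFrom lo n f ≡ 0ℚ
sumFrom-vanishing lo zero    f≗0 = refl
sumFrom-vanishing lo (suc n) f≗0 =
  trans (cong₂ ℚ._+_ (f≗0 lo) (sumFrom-vanishing (lo + + 1) n f≗0)) (ℚP.+-identityʳ 0ℚ)

sumFrom-snoc : ∀ lo n (f : ℤ → ℚ) → sumFrom lo (suc n) f ≡ sumFrom lo n f ℚ.+ f (lo + + n)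
sumFrom-snoc lo zero    f = trans (ℚP.+-comm (f lo) 0ℚ) (cong (λ w → 0ℚ ℚ.+ f w) (sym (ℤP.+-identityʳ lo)))
sumFrom-snoc lo (suc n) f = begin
  f lo ℚ.+ sumFrom (lo + + 1) (suc n) f
    ≡⟨ cong (f lo ℚ.+_) (sumFrom-snoc (lo + + 1) n f) ⟩
  f lo ℚ.+ (sumFrom (lo + + 1) n f ℚ.+ f (lo + + 1 + + n))
    ≡⟨ ℚP.+-assoc (f lo) _ _ ⟨
  f lo ℚ.+ sumFrom (lo + + 1) n f ℚ.+ f (lo + + 1 + + n)
    ≡⟨ cong (λ w → f lo ℚ.+ sumFrom (lo + + 1) n f ℚ.+ f w) (ℤP.+-assoc lo (+ 1) (+ n)) ⟩
  f lo ℚ.+ sumFrom (lo + + 1) n f ℚ.+ f (lo + + suc n) ∎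

sumFrom-pred : ∀ lo n (f : ℤ → ℚ) → sumFrom lo n (λ w → f (ℤ.pred w)) ≡ sumFrom (ℤ.pred lo) n f
sumFrom-pred lo zero    f = refl
sumFrom-pred lo (suc n) f = cong (f (ℤ.pred lo) ℚ.+_) (trans (sumFrom-pred (lo + + 1) n f)
  (cong (λ l → sumFrom l n f) (sym (ℤP.pred-+ lo (+ 1)))))

Supported : ℕ → (ℤ → ℚ) → Set
Supported M f = ∀ w → M ℕ.< ∣ w ∣ → f w ≡ 0ℚ

sumWindow-suc : ∀ N (f : ℤ → ℚ) → sumWindow (suc N) f ≡ f (ℤ.- + suc N) ℚ.+ (sumWindow N f ℚ.+ f (+ suc N))
sumWindow-suc N f = cong (f (ℤ.- + suc N) ℚ.+_) (begin
  sumFrom (ℤ.- + suc N + + 1) (suc N ℕ.+ suc N) f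
    ≡⟨ cong₂ (λ lo n → sumFrom lo n f) (left-end (+ N)) (ℕP.+-suc (suc N) N) ⟩
  sumFrom (ℤ.- + N) (suc (suc (N ℕ.+ N))) f
    ≡⟨ sumFrom-snoc (ℤ.- + N) (suc (N ℕ.+ N)) f ⟩
  sumWindow N f ℚ.+ f (ℤ.- + N + + suc (N ℕ.+ N))
    ≡⟨ cong (λ w → sumWindow N f ℚ.+ f w) (trans (cong (λ k → ℤ.- + N + (+ 1 + k)) (ℤP.pos-+ N N)) (right-end (+ N))) ⟩
  sumWindow N f ℚ.+ f (+ suc N) ∎)
  where
  left-end : ∀ n → ℤ.- (+ 1 + n) + + 1 ≡ ℤ.- n
  left-end = solve-∀
  right-end : ∀ n → ℤ.- n + (+ 1 + (n + n)) ≡ + 1 + n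
  right-end = solve-∀

sumWindow-stable : ∀ {M} {f : ℤ → ℚ} → Supported M f → ∀ {N} → M ℕ.≤ N → sumWindow N f ≡ sumWindow M f
sumWindow-stable {M} {f} f-supp M≤N = go (ℕP.≤⇒≤′ M≤N)
  where
  go : ∀ {N} → M ℕ.≤′ N → sumWindow N f ≡ sumWindow M f
  go ℕ.≤′-refl            = refl
  go (ℕ.≤′-step {N} M≤′N) = begin
    sumWindow (suc N) f                                   ≡⟨ sumWindow-suc N f ⟩
    f (ℤ.- + suc N) ℚ.+ (sumWindow N f ℚ.+ f (+ suc N))
      ≡⟨ cong₂ (λ x y → x ℚ.+ (sumWindow N f ℚ.+ y)) (f-supp _ M<1+N) (f-supp _ M<1+N) ⟩
    0ℚ ℚ.+ (sumWindow N f ℚ.+ 0ℚ)                         ≡⟨ trans (ℚP.+-identityˡ _) (ℚP.+-identityʳ _) ⟩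
    sumWindow N f                                         ≡⟨ go M≤′N ⟩
    sumWindow M f                                         ∎
    where
    M<1+N : M ℕ.< suc N
    M<1+N = ℕ.s≤s (ℕP.≤′⇒≤ M≤′N)

sumWindow-pred : ∀ {M} {f : ℤ → ℚ} → Supported M f → ∀ {N} → M ℕ.< N →
  sumWindow N (λ w → f (ℤ.pred w)) ≡ sumWindow N f
sumWindow-pred {M} {f} f-supp {N} M<N = begin
  sumFrom (ℤ.- + N) (suc (N ℕ.+ N)) (λ w → f (ℤ.pred w))
    ≡⟨ sumFrom-pred (ℤ.- + N) (suc (N ℕ.+ N)) f ⟩
  f (ℤ.pred (ℤ.- + N)) ℚ.+ sumFrom (ℤ.pred (ℤ.- + N) + + 1) (N ℕ.+ N) f
    ≡⟨ cong₂ (λ x lo → x ℚ.+ sumFrom lo (N ℕ.+ N) f) (f-supp _ M<∣pred-N∣) (pred-+1 (ℤ.- + N)) ⟩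
  0ℚ ℚ.+ sumFrom (ℤ.- + N) (N ℕ.+ N) f
    ≡⟨ trans (ℚP.+-identityˡ _) (sym (ℚP.+-identityʳ (sumFrom (ℤ.- + N) (N ℕ.+ N) f))) ⟩
  sumFrom (ℤ.- + N) (N ℕ.+ N) f ℚ.+ 0ℚ
    ≡⟨ cong (sumFrom (ℤ.- + N) (N ℕ.+ N) f ℚ.+_) (f-supp (+ N) M<N) ⟨
  sumFrom (ℤ.- + N) (N ℕ.+ N) f ℚ.+ f (+ N)
    ≡⟨ cong (λ w → sumFrom (ℤ.- + N) (N ℕ.+ N) f ℚ.+ f w)
            (trans (right-end (+ N)) (cong (_+_ (ℤ.- + N)) (sym (ℤP.pos-+ N N)))) ⟩
  sumFrom (ℤ.- + N) (N ℕ.+ N) f ℚ.+ f (ℤ.- + N + + (N ℕ.+ N))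
    ≡⟨ sumFrom-snoc (ℤ.- + N) (N ℕ.+ N) f ⟨
  sumFrom (ℤ.- + N) (suc (N ℕ.+ N)) f ∎
  where
  right-end : ∀ n → n ≡ ℤ.- n + (n + n)
  right-end = solve-∀
  pred-+1 : ∀ i → -[1+ 0 ] + i + + 1 ≡ i
  pred-+1 = solve-∀
  left-end : ∀ n → -[1+ 0 ] + ℤ.- n ≡ ℤ.- (+ 1 + n)
  left-end = solve-∀
  M<∣pred-N∣ : M ℕ.< ∣ ℤ.pred (ℤ.- + N) ∣
  M<∣pred-N∣ = ℕP.<-trans M<N (subst (λ i → N ℕ.< ∣ i ∣) (sym (left-end (+ N))) (ℕP.n<1+n N))

sumWindow-cong : ∀ N {f g : ℤ → ℚ} → (∀ w → f w ≡ g w) → sumWindow N f ≡ sumWindow N g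
sumWindow-cong N = sumFrom-cong (ℤ.- + N) (suc (N ℕ.+ N))

sumWindow-+ : ∀ N (f g : ℤ → ℚ) → sumWindow N (λ w → f w ℚ.+ g w) ≡ sumWindow N f ℚ.+ sumWindow N g
sumWindow-+ N = sumFrom-+ (ℤ.- + N) (suc (N ℕ.+ N))

sumWindow-vanishing : ∀ N {f : ℤ → ℚ} → (∀ w → f w ≡ 0ℚ) → sumWindow N f ≡ 0ℚ
sumWindow-vanishing N = sumFrom-vanishing (ℤ.- + N) (suc (N ℕ.+ N))

Δ : (ℤ → ℚ) → ℤ → ℚ
Δ P w = P (ℤ.suc w) ℚ.- P w

HasDegree< : ℕ → (ℤ → ℚ) → Set
HasDegree< zero    P = ∀ w → P w ≡ 0ℚ
HasDegree< (suc d) P = HasDegree< d (Δ P)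

hasDegree<-cong : ∀ d {P Q} → (∀ w → P w ≡ Q w) → HasDegree< d P → HasDegree< d Q
hasDegree<-cong zero    P≗Q P<d w = trans (sym (P≗Q w)) (P<d w)
hasDegree<-cong (suc d) P≗Q P<d =
  hasDegree<-cong d (λ w → cong₂ ℚ._-_ (P≗Q (ℤ.suc w)) (P≗Q w)) P<d

hasDegree<-suc : ∀ d {P} → HasDegree< d P → HasDegree< (suc d) P
hasDegree<-suc zero    P≗0 w = trans (cong₂ ℚ._-_ (P≗0 (ℤ.suc w)) (P≗0 w)) (ℚP.+-inverseʳ 0ℚ)
hasDegree<-suc (suc d) P<d = hasDegree<-suc d P<d

hasDegree<-const : ∀ d c → HasDegree< (suc d) (λ _ → c)
hasDegree<-const zero    c w = ℚP.+-inverseʳ c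
hasDegree<-const (suc d) c = hasDegree<-suc (suc d) {λ _ → c} (hasDegree<-const d c)

hasDegree<-shift : ∀ d {P} → HasDegree< d P → HasDegree< d (λ w → P (ℤ.suc w))
hasDegree<-shift zero    P≗0 w = P≗0 (ℤ.suc w)
hasDegree<-shift (suc d) P<d = hasDegree<-shift d P<d

hasDegree<-+ : ∀ d {P Q} → HasDegree< d P → HasDegree< d Q → HasDegree< d (λ w → P w ℚ.+ Q w)
hasDegree<-+ zero    P≗0 Q≗0 w = trans (cong₂ ℚ._+_ (P≗0 w) (Q≗0 w)) (ℚP.+-identityʳ 0ℚ)
hasDegree<-+ (suc d) {P} {Q} P<d Q<d =
  hasDegree<-cong d (λ w → sym (Δ-+ (P (ℤ.suc w)) (P w) (Q (ℤ.suc w)) (Q w))) (hasDegree<-+ d P<d Q<d)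
  where
  open +-*-Solver
  Δ-+ : ∀ p p′ q q′ → (p ℚ.+ q) ℚ.- (p′ ℚ.+ q′) ≡ (p ℚ.- p′) ℚ.+ (q ℚ.- q′)
  Δ-+ = solve 4 (λ p p′ q q′ → (p :+ q) :- (p′ :+ q′) := (p :- p′) :+ (q :- q′)) refl

hasDegree<-ℤtoℚ-* : ∀ d {E} → HasDegree< d E → HasDegree< (suc d) (λ w → ℤtoℚ w * E w)
hasDegree<-ℤtoℚ-* zero {E} E≗0 w = begin
  ℤtoℚ (ℤ.suc w) * E (ℤ.suc w) ℚ.- ℤtoℚ w * E w
    ≡⟨ cong₂ (λ x y → ℤtoℚ (ℤ.suc w) * x ℚ.- ℤtoℚ w * y) (E≗0 (ℤ.suc w)) (E≗0 w) ⟩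
  ℤtoℚ (ℤ.suc w) * 0ℚ ℚ.- ℤtoℚ w * 0ℚ
    ≡⟨ annihilate (ℤtoℚ (ℤ.suc w)) (ℤtoℚ w) ⟩
  0ℚ ∎
  where
  open +-*-Solver
  annihilate : ∀ x y → x * 0ℚ ℚ.- y * 0ℚ ≡ 0ℚ
  annihilate = solve 2 (λ x y → x :* con 0ℚ :- y :* con 0ℚ := con 0ℚ) refl
hasDegree<-ℤtoℚ-* (suc d) {E} ΔE<d = hasDegree<-cong (suc d) product-rule
  (hasDegree<-+ (suc d) {λ w → ℤtoℚ w * Δ E w} (hasDegree<-ℤtoℚ-* d ΔE<d) (hasDegree<-shift (suc d) {E} ΔE<d))
  where
  open +-*-Solver
  expand : ∀ x e e′ → (1ℚ ℚ.+ x) * e′ ℚ.- x * e ≡ x * (e′ ℚ.- e) ℚ.+ e′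
  expand = solve 3 (λ x e e′ → (con 1ℚ :+ x) :* e′ :- x :* e := x :* (e′ :- e) :+ e′) refl
  product-rule : ∀ w → ℤtoℚ w * Δ E w ℚ.+ E (ℤ.suc w) ≡ Δ (λ v → ℤtoℚ v * E v) w
  product-rule w = sym (trans (cong (λ x → x * E (ℤ.suc w) ℚ.- ℤtoℚ w * E w) (ℤtoℚ-suc w))
                              (expand (ℤtoℚ w) (E w) (E (ℤ.suc w))))

evalPoly-hasDegree< : ∀ {n} (cs : Vec ℚ n) → HasDegree< n (λ w → evalPoly cs (ℤtoℚ w))
evalPoly-hasDegree< []                = λ _ → refl
evalPoly-hasDegree< {suc n} (c ∷ cs) =
  hasDegree<-+ (suc n) {λ _ → c} (hasDegree<-const n c) (hasDegree<-ℤtoℚ-* n (evalPoly-hasDegree< cs))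

radius : ℤ → ℤ → ℤ → ℕ
radius A B m = ∣ A ∣ ℕ.+ ∣ B ∣ ℕ.+ ∣ m ∣

ConvSupported : (ℤ → ℤ → ℚ) → Set
ConvSupported f = ∀ A B m w → radius A B m ℕ.< ∣ w ∣ → f A w * f B (m - w) ≡ 0ℚ

convTerm : (ℤ → ℤ → ℚ) → (ℤ → ℚ) → ℤ → ℤ → ℤ → ℤ → ℚ
convTerm f P A B m w = P w * f A w * f B (m - w)

conv : (ℤ → ℤ → ℚ) → (ℤ → ℚ) → ℤ → ℤ → ℤ → ℚ
conv f P A B m = sumWindow (radius A B m) (convTerm f P A B m)

convTerm-supported : ∀ f → ConvSupported f → ∀ P A B m → Supported (radius A B m) (convTerm f P A B m)
convTerm-supported f f-supp P A B m w r<∣w∣ = begin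
  P w * f A w * f B (m - w)   ≡⟨ ℚP.*-assoc (P w) (f A w) (f B (m - w)) ⟩
  P w * (f A w * f B (m - w)) ≡⟨ cong (P w *_) (f-supp A B m w r<∣w∣) ⟩
  P w * 0ℚ                    ≡⟨ ℚP.*-zeroʳ (P w) ⟩
  0ℚ                          ∎

conv-window : ∀ f → ConvSupported f → ∀ P A B m {N} → radius A B m ℕ.≤ N →
  sumWindow N (convTerm f P A B m) ≡ conv f P A B m
conv-window f f-supp P A B m = sumWindow-stable (convTerm-supported f f-supp P A B m)

conv-vanishing : ∀ f {P} → (∀ w → P w ≡ 0ℚ) → ∀ A B m → conv f P A B m ≡ 0ℚ
conv-vanishing f {P} P≗0 A B m = sumWindow-vanishing (radius A B m) λ w →
  trans (cong (λ p → p * f A w * f B (m - w)) (P≗0 w))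
        (trans (cong (_* f B (m - w)) (ℚP.*-zeroˡ (f A w))) (ℚP.*-zeroˡ (f B (m - w))))

∣suc∣≤ : ∀ i → ∣ ℤ.suc i ∣ ℕ.≤ suc ∣ i ∣
∣suc∣≤ = ℤP.∣i+j∣≤∣i∣+∣j∣ (+ 1)

∣pred∣≤ : ∀ i → ∣ ℤ.pred i ∣ ℕ.≤ suc ∣ i ∣
∣pred∣≤ = ℤP.∣i+j∣≤∣i∣+∣j∣ -[1+ 0 ]

conv-pascal : ∀ f → IsPascal f → ConvSupported f → ∀ P A B m →
  conv f P (ℤ.suc A) B m ≡ conv f P A (ℤ.suc B) m ℚ.+ conv f (Δ P) A B (ℤ.pred m)
conv-pascal f f-pascal f-supp P A B m = begin
  conv f P (ℤ.suc A) B m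
    ≡⟨ conv-window f f-supp P (ℤ.suc A) B m r[1+A]≤N ⟨
  sumWindow N (convTerm f P (ℤ.suc A) B m)
    ≡⟨ sumWindow-cong N split-A ⟩
  sumWindow N (λ w → X w ℚ.+ Y (ℤ.pred w))
    ≡⟨ sumWindow-+ N X (λ w → Y (ℤ.pred w)) ⟩
  sumWindow N X ℚ.+ sumWindow N (λ w → Y (ℤ.pred w))
    ≡⟨ cong (sumWindow N X ℚ.+_) (sumWindow-pred (convTerm-supported f f-supp P₊ A B (ℤ.pred m)) r[m-1]<N) ⟩
  sumWindow N X ℚ.+ sumWindow N Y
    ≡⟨ sumWindow-+ N X Y ⟨
  sumWindow N (λ w → X w ℚ.+ Y w)
    ≡⟨ sumWindow-cong N merge-B ⟩
  sumWindow N (λ w → convTerm f P A (ℤ.suc B) m w ℚ.+ convTerm f (Δ P) A B (ℤ.pred m) w)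
    ≡⟨ sumWindow-+ N (convTerm f P A (ℤ.suc B) m) (convTerm f (Δ P) A B (ℤ.pred m)) ⟩
  sumWindow N (convTerm f P A (ℤ.suc B) m) ℚ.+ sumWindow N (convTerm f (Δ P) A B (ℤ.pred m))
    ≡⟨ cong₂ ℚ._+_ (conv-window f f-supp P A (ℤ.suc B) m r[1+B]≤N)
                   (conv-window f f-supp (Δ P) A B (ℤ.pred m) (ℕP.<⇒≤ r[m-1]<N)) ⟩
  conv f P A (ℤ.suc B) m ℚ.+ conv f (Δ P) A B (ℤ.pred m) ∎
  where
  N : ℕ
  N = suc ∣ A ∣ ℕ.+ suc ∣ B ∣ ℕ.+ suc ∣ m ∣
  r[1+A]≤N : radius (ℤ.suc A) B m ℕ.≤ N
  r[1+A]≤N = ℕP.+-mono-≤ (ℕP.+-mono-≤ (∣suc∣≤ A) (ℕP.n≤1+n ∣ B ∣)) (ℕP.n≤1+n ∣ m ∣)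
  r[1+B]≤N : radius A (ℤ.suc B) m ℕ.≤ N
  r[1+B]≤N = ℕP.+-mono-≤ (ℕP.+-mono-≤ (ℕP.n≤1+n ∣ A ∣) (∣suc∣≤ B)) (ℕP.n≤1+n ∣ m ∣)
  r[m-1]<N : radius A B (ℤ.pred m) ℕ.< N
  r[m-1]<N = ℕP.+-mono-≤ (ℕP.+-mono-≤ (ℕP.≤-refl {suc ∣ A ∣}) (ℕP.n≤1+n ∣ B ∣)) (∣pred∣≤ m)
  P₊ : ℤ → ℚ
  P₊ w = P (ℤ.suc w)
  X Y : ℤ → ℚ
  X = convTerm f P A B m
  Y = convTerm f P₊ A B (ℤ.pred m)
  open +-*-Solver
  distrib : ∀ p a a′ b → p * (a ℚ.+ a′) * b ≡ p * a * b ℚ.+ p * a′ * b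
  distrib = solve 4 (λ p a a′ b → p :* (a :+ a′) :* b := p :* a :* b :+ p :* a′ :* b) refl
  regroup : ∀ p p₊ a b b′ → p * a * b ℚ.+ p₊ * a * b′ ≡ p * a * (b ℚ.+ b′) ℚ.+ (p₊ ℚ.- p) * a * b′
  regroup = solve 5 (λ p p₊ a b b′ → p :* a :* b :+ p₊ :* a :* b′ := p :* a :* (b :+ b′) :+ (p₊ :- p) :* a :* b′) refl
  shift-index : ∀ m w → m - w ≡ (-[1+ 0 ] + m) - (-[1+ 0 ] + w)
  shift-index = solve-∀
  split-A : ∀ w → convTerm f P (ℤ.suc A) B m w ≡ X w ℚ.+ Y (ℤ.pred w)
  split-A w = begin
    P w * f (ℤ.suc A) w * f B (m - w)
      ≡⟨ cong (λ a → P w * a * f B (m - w)) (f-pascal A w) ⟩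
    P w * (f A w ℚ.+ f A (ℤ.pred w)) * f B (m - w)
      ≡⟨ distrib (P w) (f A w) (f A (ℤ.pred w)) (f B (m - w)) ⟩
    X w ℚ.+ P w * f A (ℤ.pred w) * f B (m - w)
      ≡⟨ cong₂ (λ v i → X w ℚ.+ P v * f A (ℤ.pred w) * f B i) (sym (ℤP.suc-pred w)) (shift-index m w) ⟩
    X w ℚ.+ Y (ℤ.pred w) ∎
  merge-B : ∀ w → X w ℚ.+ Y w ≡ convTerm f P A (ℤ.suc B) m w ℚ.+ convTerm f (Δ P) A B (ℤ.pred m) w
  merge-B w = begin
    P w * f A w * f B (m - w) ℚ.+ P₊ w * f A w * f B (ℤ.pred m - w)
      ≡⟨ regroup (P w) (P₊ w) (f A w) (f B (m - w)) (f B (ℤ.pred m - w)) ⟩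
    P w * f A w * (f B (m - w) ℚ.+ f B (ℤ.pred m - w)) ℚ.+ Δ P w * f A w * f B (ℤ.pred m - w)
      ≡⟨ cong (λ b → P w * f A w * b ℚ.+ Δ P w * f A w * f B (ℤ.pred m - w))
              (sym (trans (f-pascal B (m - w)) (cong (λ i → f B (m - w) ℚ.+ f B i) (sym (ℤP.pred-+ m (ℤ.- w)))))) ⟩
    P w * f A w * f (ℤ.suc B) (m - w) ℚ.+ Δ P w * f A w * f B (ℤ.pred m - w) ∎

module _ (f g : ℤ → ℤ → ℚ)
  (f-pascal : IsPascal f) (f-supp : ConvSupported f)
  (g-pascal : IsPascal g) (g-supp : ConvSupported g)
  (f≗g-on-ℕ : ∀ n w → f (+ n) w ≡ g (+ n) w) where

  private
    agree-on-ℕ : ∀ P a b m → conv f P (+ a) (+ b) m ≡ conv g P (+ a) (+ b) m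
    agree-on-ℕ P a b m = sumWindow-cong (radius (+ a) (+ b) m)
      (λ w → cong₂ (λ x y → P w * x * y) (f≗g-on-ℕ a w) (f≗g-on-ℕ b (m - w)))

    transfer-to-suc-A : ∀ P A B m → conv f P A (ℤ.suc B) m ≡ conv g P A (ℤ.suc B) m →
      conv f (Δ P) A B (ℤ.pred m) ≡ conv g (Δ P) A B (ℤ.pred m) →
      conv f P (ℤ.suc A) B m ≡ conv g P (ℤ.suc A) B m
    transfer-to-suc-A P A B m agree₁ agree₂ = begin
      conv f P (ℤ.suc A) B m                                   ≡⟨ conv-pascal f f-pascal f-supp P A B m ⟩
      conv f P A (ℤ.suc B) m ℚ.+ conv f (Δ P) A B (ℤ.pred m)   ≡⟨ cong₂ ℚ._+_ agree₁ agree₂ ⟩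
      conv g P A (ℤ.suc B) m ℚ.+ conv g (Δ P) A B (ℤ.pred m)   ≡⟨ conv-pascal g g-pascal g-supp P A B m ⟨
      conv g P (ℤ.suc A) B m                                   ∎

    transfer-to-suc-B : ∀ P A B m → conv f P (ℤ.suc A) B m ≡ conv g P (ℤ.suc A) B m →
      conv f (Δ P) A B (ℤ.pred m) ≡ conv g (Δ P) A B (ℤ.pred m) →
      conv f P A (ℤ.suc B) m ≡ conv g P A (ℤ.suc B) m
    transfer-to-suc-B P A B m agree₁ agree₂ = +-cancelʳ (conv f (Δ P) A B (ℤ.pred m)) _ _ (begin
      conv f P A (ℤ.suc B) m ℚ.+ conv f (Δ P) A B (ℤ.pred m)   ≡⟨ conv-pascal f f-pascal f-supp P A B m ⟨
      conv f P (ℤ.suc A) B m                                   ≡⟨ agree₁ ⟩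
      conv g P (ℤ.suc A) B m                                   ≡⟨ conv-pascal g g-pascal g-supp P A B m ⟩
      conv g P A (ℤ.suc B) m ℚ.+ conv g (Δ P) A B (ℤ.pred m)   ≡⟨ cong (conv g P A (ℤ.suc B) m ℚ.+_) agree₂ ⟨
      conv g P A (ℤ.suc B) m ℚ.+ conv f (Δ P) A B (ℤ.pred m)   ∎)

    suc-+-comm : ∀ i j → (+ 1 + i) + j ≡ i + (+ 1 + j)
    suc-+-comm = solve-∀

  conv-agree : ∀ d P → HasDegree< d P → ∀ A B m → + d ℤ.≤ ℤ.suc (A + B) → conv f P A B m ≡ conv g P A B m
  conv-agree zero    P P≗0 A B m _ = trans (conv-vanishing f P≗0 A B m) (sym (conv-vanishing g P≗0 A B m))
  conv-agree (suc d) P P<d A B m d<A+B+1 =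
    agree A B m (subst₂ ℤ._≤_ (ℤP.pred-suc (+ d)) (ℤP.pred-suc (A + B)) (ℤP.pred-mono d<A+B+1))
    where
    agree-Δ : ∀ A B m → + d ℤ.≤ ℤ.suc (A + B) → conv f (Δ P) A B (ℤ.pred m) ≡ conv g (Δ P) A B (ℤ.pred m)
    agree-Δ A B m = conv-agree d (Δ P) P<d A B (ℤ.pred m)
    at-suc-A : ∀ A B m → + d ℤ.≤ ℤ.suc A + B →
      (+ d ℤ.≤ A + ℤ.suc B → conv f P A (ℤ.suc B) m ≡ conv g P A (ℤ.suc B) m) →
      conv f P (ℤ.suc A) B m ≡ conv g P (ℤ.suc A) B m
    at-suc-A A B m d≤ agree-neighbour = transfer-to-suc-A P A B m
      (agree-neighbour (subst (+ d ℤ.≤_) (suc-+-comm A B) d≤))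
      (agree-Δ A B m (subst (+ d ℤ.≤_) (ℤP.+-assoc (+ 1) A B) d≤))
    at-suc-B : ∀ A B m → + d ℤ.≤ A + ℤ.suc B →
      (+ d ℤ.≤ ℤ.suc A + B → conv f P (ℤ.suc A) B m ≡ conv g P (ℤ.suc A) B m) →
      conv f P A (ℤ.suc B) m ≡ conv g P A (ℤ.suc B) m
    at-suc-B A B m d≤ agree-neighbour = transfer-to-suc-B P A B m
      (agree-neighbour (subst (+ d ℤ.≤_) (sym (suc-+-comm A B)) d≤))
      (agree-Δ A B m (subst (+ d ℤ.≤_) (trans (sym (suc-+-comm A B)) (ℤP.+-assoc (+ 1) A B)) d≤))
    agree : ∀ A B m → + d ℤ.≤ A + B → conv f P A B m ≡ conv g P A B m
    agree (+ a)        (+ b)        m _  = agree-on-ℕ P a b m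
    agree (+ zero)     -[1+ n ]     m ()
    agree -[1+ n ]     (+ zero)     m ()
    agree -[1+ _ ]     -[1+ _ ]     m ()
    agree (+ suc a)    -[1+ zero ]  m d≤ = at-suc-A (+ a) -[1+ 0 ] m d≤ (agree (+ a) (+ 0) m)
    agree (+ suc a)    -[1+ suc n ] m d≤ = at-suc-A (+ a) -[1+ suc n ] m d≤ (agree (+ a) -[1+ n ] m)
    agree -[1+ zero ]  (+ suc b)    m d≤ = at-suc-B -[1+ 0 ] (+ b) m d≤ (agree (+ 0) (+ b) m)
    agree -[1+ suc n ] (+ suc b)    m d≤ = at-suc-B -[1+ suc n ] (+ b) m d≤ (agree -[1+ n ] (+ b) m)

∣A∣≤radius : ∀ A B m → ∣ A ∣ ℕ.≤ radius A B m
∣A∣≤radius A B m = ℕP.≤-trans (ℕP.m≤m+n ∣ A ∣ ∣ B ∣) (ℕP.m≤m+n _ ∣ m ∣)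

∣m∣≤radius : ∀ A B m → ∣ m ∣ ℕ.≤ radius A B m
∣m∣≤radius A B m = ℕP.m≤n+m ∣ m ∣ (∣ A ∣ ℕ.+ ∣ B ∣)

∣B-m∣≤radius : ∀ A B m → ∣ B - m ∣ ℕ.≤ radius A B m
∣B-m∣≤radius A B m = ℕP.≤-trans (ℤP.∣i-j∣≤∣i∣+∣j∣ B m) (ℕP.+-monoˡ-≤ ∣ m ∣ (ℕP.m≤n+m ∣ B ∣ ∣ A ∣))

mbinom-convSupported : ConvSupported mbinom
mbinom-convSupported A B m (+ k) r<k = begin
  mbinom A (+ k) * mbinom B (m - + k) ≡⟨ cong (_* mbinom B (m - + k)) first-vanishes ⟩
  0ℚ * mbinom B (m - + k)             ≡⟨ ℚP.*-zeroˡ (mbinom B (m - + k)) ⟩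
  0ℚ                                  ∎
  where
  first-vanishes : mbinom A (+ k) ≡ 0ℚ
  first-vanishes = trans (mbinom≡choose A (+ k)) (choose-below A A (ℕP.≤-<-trans (∣A∣≤radius A B m) r<k))
mbinom-convSupported A B m -[1+ k ] r<k = begin
  mbinom A -[1+ k ] * mbinom B (m - -[1+ k ]) ≡⟨ cong (mbinom A -[1+ k ] *_) second-vanishes ⟩
  mbinom A -[1+ k ] * 0ℚ                      ≡⟨ ℚP.*-zeroʳ (mbinom A -[1+ k ]) ⟩
  0ℚ                                          ∎
  where
  reindex : ∀ B m s → B - (m - ℤ.- s) ≡ B - m - s
  reindex = solve-∀
  second-vanishes : mbinom B (m - -[1+ k ]) ≡ 0ℚ
  second-vanishes = begin
    mbinom B (m - -[1+ k ])       ≡⟨ mbinom≡choose B (m - -[1+ k ]) ⟩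
    choose B (B - (m - -[1+ k ])) ≡⟨ cong (choose B) (reindex B m (+ suc k)) ⟩
    choose B (B - m - + suc k)    ≡⟨ choose-below B (B - m) (ℕP.≤-<-trans (∣B-m∣≤radius A B m) r<k) ⟩
    0ℚ                            ∎

choose-convSupported : ConvSupported choose
choose-convSupported A B m (+ k) r<k = begin
  choose A (+ k) * choose B (m - + k) ≡⟨ cong (choose A (+ k) *_) (choose-below B m (ℕP.≤-<-trans (∣m∣≤radius A B m) r<k)) ⟩
  choose A (+ k) * 0ℚ                 ≡⟨ ℚP.*-zeroʳ (choose A (+ k)) ⟩
  0ℚ                                  ∎
choose-convSupported A B m -[1+ k ] r<k = ℚP.*-zeroˡ (choose B (m - -[1+ k ]))

lemma2p4 : (A B : ℤ) (q : ℕ) (m : ℤ) → (A + B) ℤ.≥ + q →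
    (P : Vec ℚ (suc q)) → leading P ≢ 0ℚ →
    (N : ℕ) → N ℕ.≥ ∣ A ∣ ℕ.+ ∣ B ∣ ℕ.+ ∣ m ∣ →
    sumWindow N (λ w → evalPoly P (ℤtoℚ w) * mbinom A w * mbinom B (m - w))
      ≡ sumWindow N (λ w → evalPoly P (ℤtoℚ w) * mbinom A (A - w) * mbinom B (B - m + w))
-- The identity holds for every P of degree at most q, so the leading coefficient plays no role.
lemma2p4 A B q m q≤A+B P _ N r≤N = begin
  sumWindow N (convTerm mbinom P′ A B m)
    ≡⟨ conv-window mbinom mbinom-convSupported P′ A B m r≤N ⟩
  conv mbinom P′ A B m
    ≡⟨ conv-agree mbinom choose mbinom-isPascal mbinom-convSupported choose-isPascal choose-convSupported
         mbinom≗choose-on-ℕ (suc q) P′ (evalPoly-hasDegree< P) A B m (ℤP.+-monoʳ-≤ (+ 1) q≤A+B) ⟩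
  conv choose P′ A B m
    ≡⟨ conv-window choose choose-convSupported P′ A B m r≤N ⟨
  sumWindow N (convTerm choose P′ A B m)
    ≡⟨ sumWindow-cong N (λ w → cong₂ (λ x y → P′ w * x * y) (sym (mbinom[A-k]≡choose A w)) (choose≡mbinom-B w)) ⟩
  sumWindow N (λ w → P′ w * mbinom A (A - w) * mbinom B (B - m + w)) ∎
  where
  P′ : ℤ → ℚ
  P′ w = evalPoly P (ℤtoℚ w)
  reassoc : ∀ B m w → B - m + w ≡ B - (m - w)
  reassoc = solve-∀
  choose≡mbinom-B : ∀ w → choose B (m - w) ≡ mbinom B (B - m + w)
  choose≡mbinom-B w = sym (trans (cong (mbinom B) (reassoc B m w)) (mbinom[A-k]≡choose B (m - w)))
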